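{- For integers $t,r$ with $t+1\le r\le 3t-1$, we have \[ R(r,t) = \left\lfloor \frac{r-t}{2} \right\rfloor + 1. \]
   Context: All hypergraphs are finite. An $r$-uniform hypergraph $\mathcal H$ is $r$-partite if its vertex set can be partitioned as $V(\mathcal H)=P_1\sqcup\dots\sqcup P_r$ such that $|e\cap P_j|=1$ for every edge $e$ and every $j\in[r]$. It is $t$-intersecting if $|e\cap f|\ge t$ for all $e,f\in E(\mathcal H)$. An $(r,t)$-graph is an $r$-uniform, $r$-partite, $t$-intersecting hypergraph. A cover of $\mathcal H$ is a set $C\subseteq V(\mathcal H)$ with $C\cap e\neq\emptyset$ for every edge $e$; the cover number $\tau(\mathcal H)$ is the minimum size of a cover. $R(r,t)$ denotes the maximum of $\tau(\mathcal H)$ over all $(r,t)$-graphs $\mathcal H$. -}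

module Defs where

open import Data.Nat using (ℕ; _≤_; _≡ᵇ_)
open import Data.Fin using (Fin; _≟_)
open import Data.Fin.Subset using (Subset; _∩_; ∣_∣; Nonempty)
open import Data.Vec using (tabulate)
open import Data.List using (List)
open import Data.List.Membership.Propositional using (_∈_)
open import Data.Product using (Σ; ∃; _×_)
open import Relation.Binary.PropositionalEquality using (_≡_)
open import Relation.Nullary.Decidable using (does)

-- A finite hypergraph: vertex set Fin n, edge set given as a finite list of
-- subsets of the vertex set (repetitions are irrelevant for all notions below).
record Hypergraph : Set where
  constructor hypergraph
  field
    n     : ℕ
    edges : List (Subset n)

open Hypergraph public

IsUniform : ℕ → Hypergraph → Set
IsUniform r H = ∀ {e} → e ∈ edges H → ∣ e ∣ ≡ r

part : ∀ {n r} → (Fin n → Fin r) → Fin r → Subset n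
part p j = tabulate (λ v → does (p v ≟ j))

-- r-partite: V = P_1 ⊔ … ⊔ P_r (given by a labelling p : V → [r]) with
-- |e ∩ P_j| = 1 for every edge e and every j.
IsPartite : ℕ → Hypergraph → Set
IsPartite r H = Σ (Fin (n H) → Fin r) λ p →
  ∀ {e} → e ∈ edges H → ∀ (j : Fin r) → ∣ e ∩ part p j ∣ ≡ 1

IsIntersecting : ℕ → Hypergraph → Set
IsIntersecting t H = ∀ {e f} → e ∈ edges H → f ∈ edges H → t ≤ ∣ e ∩ f ∣

IsRTGraph : ℕ → ℕ → Hypergraph → Set
IsRTGraph r t H = IsUniform r H × IsPartite r H × IsIntersecting t H

IsCover : (H : Hypergraph) → Subset (n H) → Set
IsCover H C = ∀ {e} → e ∈ edges H → Nonempty (C ∩ e)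

CoverNumber : Hypergraph → ℕ → Set
CoverNumber H k =
  (Σ (Subset (n H)) λ C → IsCover H C × ∣ C ∣ ≡ k) ×
  (∀ (C : Subset (n H)) → IsCover H C → k ≤ ∣ C ∣)

IsR : ℕ → ℕ → ℕ → Set
IsR r t m =
  (Σ Hypergraph λ H → IsRTGraph r t H × CoverNumber H m) ×
  (∀ (H : Hypergraph) → IsRTGraph r t H → ∀ k → CoverNumber H k → k ≤ m)

module Submission where

open import Defs
open import Data.Nat using (ℕ; suc; _+_; _*_; _∸_; _≤_; ⌊_/2⌋)

-- Let H be an (r,t)-graph and e, f edges for which
-- s = |e ∩ f| is minimal, so t ≤ s ≤ r.  Counting part by part, any three
-- edges of an r-partite hypergraph satisfy
--   |g ∩ e| + |g ∩ f| + |e ∩ f| ≤ r + 2 |g ∩ e ∩ f|.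
-- Choose C ⊆ e ∩ f with |C| = c = ⌊(r-s)/2⌋ + 1 (c ≤ s since r < 3s).  If an
-- edge g missed C, then g ∩ e ∩ f and C would be disjoint inside e ∩ f,
-- so 3s ≤ r + 2(s - c), contradicting 2c > r - s.  Hence τ(H) ≤ c ≤ ⌊(r-t)/2⌋ + 1.
--
-- Put ρ = ⌊(r-t)/2⌋ and q = ρ + 1.  On the grid [r] × [q]
-- (parts = rows) take, for every word x ∈ [q]^r with at most ρ nonzero
-- letters, the edge {(i, x_i)}.  Two such edges agree in at least r - 2ρ ≥ t
-- rows.  The points (i, 0) of any q rows form a cover, and a set C of at most
-- ρ points misses the edge of the word that, in each row i, uses a letter
-- outside C, which is nonzero only if (i, 0) ∈ C.

open import Data.Nat using (zero; _<_; z≤n; s≤s; s≤s⁻¹; _≤?_; ⌈_/2⌉)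
open import Data.Nat.Properties hiding (_≟_)
open import Data.Nat.Tactic.RingSolver using (solve-∀)
open import Data.Bool using (Bool; true; false; _∧_; _∨_; not)
open import Data.Bool.Properties using (∧-identityʳ; ∧-zeroʳ)
open import Data.Fin as F using (Fin; _≟_; combine; remQuot; _↑ˡ_; _↑ʳ_)
open import Data.Fin.Properties using (remQuot-combine; combine-remQuot)
open import Data.Fin.Subset
  using (Subset; _∩_; ∣_∣; Nonempty; Empty; ⊤; ⊥; _⊆_; _∈_)
open import Data.Fin.Subset.Properties
  using (∣⊥∣≡0; ∣⊤∣≡n; ⊥⊆; s⊆s; nonempty?; Empty-unique; x∈p∩q⁺; x∈p∩q⁻; ∣p∩q∣≤∣p∣)
open import Data.Vec using (Vec; []; _∷_; lookup; tabulate)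
open import Data.Vec.Properties using (lookup-zipWith; lookup∘tabulate; lookup⇒[]=; []=⇒lookup)
open import Data.List using (List; []; _∷_; map; filter; allFin; cartesianProduct; cartesianProductWith)
open import Data.List.Membership.Propositional renaming (_∈_ to _∈ˡ_)
open import Data.List.Membership.Propositional.Properties
  using (∈-map⁺; ∈-map⁻; ∈-filter⁺; ∈-filter⁻; ∈-allFin; ∈-cartesianProduct⁺; ∈-cartesianProduct⁻; ∈-cartesianProductWith⁺)
open import Data.List.Relation.Unary.All as All using (All)
open import Data.List.Relation.Unary.Any using (here)
open import Data.List.Extrema.Nat using (argmin; f[argmin]≤f[xs]; argmin-all)
open import Data.Product as Prod using (Σ; ∃; ∃₂; _×_; _,_; proj₁; proj₂; uncurry)
open import Function using (_∘_; id)
open import Relation.Binary.PropositionalEquality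
open import Relation.Nullary using (does; yes; no; contradiction)
open import Algebra.Properties.Semiring.Sum +-*-semiring
  using (sum; sum-syntax; sum-cong-≗; ∑-distrib-+; ∑-comm; sum-replicate-zero; *-distribˡ-sum)

χ : Bool → ℕ
χ true  = 1
χ false = 0

count : ∀ {n} → (Fin n → Bool) → ℕ
count {n} P = ∑[ v < n ] χ (P v)

count-cong : ∀ {n} {P Q : Fin n → Bool} → (∀ v → P v ≡ Q v) → count P ≡ count Q
count-cong P≗Q = sum-cong-≗ (cong χ ∘ P≗Q)

∑-mono-≤ : ∀ {n} {f g : Fin n → ℕ} → (∀ i → f i ≤ g i) → sum f ≤ sum g
∑-mono-≤ {zero}  _   = z≤n
∑-mono-≤ {suc n} f≤g = +-mono-≤ (f≤g F.zero) (∑-mono-≤ (f≤g ∘ F.suc))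

∑-one : ∀ n → ∑[ i < n ] 1 ≡ n
∑-one zero    = refl
∑-one (suc n) = cong suc (∑-one n)

∑-zero : ∀ n → ∑[ i < n ] 0 ≡ 0
∑-zero n = sum-replicate-zero n

term≤∑ : ∀ {n} (f : Fin n → ℕ) i → f i ≤ sum f
term≤∑ f F.zero    = m≤m+n _ _
term≤∑ f (F.suc i) = ≤-trans (term≤∑ (f ∘ F.suc) i) (m≤n+m _ _)

∑-+₃ : ∀ {n} (f g h : Fin n → ℕ) → ∑[ i < n ] (f i + g i + h i) ≡ sum f + sum g + sum h
∑-+₃ f g h = trans (∑-distrib-+ (λ i → f i + g i) h) (cong (_+ sum h) (∑-distrib-+ f g))

∑-++ : ∀ m {n} (f : Fin (m + n) → ℕ) → sum f ≡ ∑[ i < m ] f (i ↑ˡ n) + ∑[ i < n ] f (m ↑ʳ i)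
∑-++ zero    f = refl
∑-++ (suc m) {n} f = trans (cong (f F.zero +_) (∑-++ m (f ∘ F.suc)))
  (sym (+-assoc (f F.zero) (∑[ i < m ] f (F.suc (i ↑ˡ n))) (∑[ i < n ] f (suc m ↑ʳ i))))

∑-combine : ∀ m {q} (f : Fin (m * q) → ℕ) → sum f ≡ ∑[ i < m ] ∑[ a < q ] f (combine i a)
∑-combine zero        f = refl
∑-combine (suc m) {q} f =
  trans (∑-++ q f) (cong (∑[ a < q ] f (a ↑ˡ (m * q)) +_) (∑-combine m (f ∘ (q ↑ʳ_))))

χ≤1 : ∀ b → χ b ≤ 1
χ≤1 true  = ≤-refl
χ≤1 false = z≤n

count-at : ∀ {n} (b : Fin n) (Q : Fin n → Bool) → count (λ a → does (b ≟ a) ∧ Q a) ≡ χ (Q b)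
count-at {suc n} F.zero    Q = trans (cong (χ (Q F.zero) +_) (∑-zero n)) (+-identityʳ _)
count-at {suc n} (F.suc b) Q = count-at b (Q ∘ F.suc)

count-≟ : ∀ {n} (b : Fin n) → count (λ a → does (b ≟ a)) ≡ 1
count-≟ {n} b = trans (count-cong {n} (λ a → sym (∧-identityʳ (does (b ≟ a))))) (count-at b (λ _ → true))

count-≟′ : ∀ {n} (b : Fin n) → count (λ a → does (a ≟ b)) ≡ 1
count-≟′ {suc n} F.zero    = cong suc (∑-zero n)
count-≟′ {suc n} (F.suc b) = count-≟′ b

count-<⇒witness : ∀ {n} (P Q : Fin n → Bool) → count P < count Q → ∃ λ v → Q v ≡ true × P v ≡ false
count-<⇒witness {zero}  P Q ()
count-<⇒witness {suc n} P Q P<Q with P F.zero in eqP | Q F.zero in eqQ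
... | false | true  = F.zero , eqQ , eqP
... | true  | true  = Prod.map F.suc id (count-<⇒witness (P ∘ F.suc) (Q ∘ F.suc) (s≤s⁻¹ P<Q))
... | false | false = Prod.map F.suc id (count-<⇒witness (P ∘ F.suc) (Q ∘ F.suc) P<Q)
... | true  | false = Prod.map F.suc id (count-<⇒witness (P ∘ F.suc) (Q ∘ F.suc) (m+n≤o⇒n≤o 1 P<Q))

lookup-∩ : ∀ {n} (X Y : Subset n) v → lookup (X ∩ Y) v ≡ lookup X v ∧ lookup Y v
lookup-∩ X Y v = lookup-zipWith _∧_ v X Y

size≡count : ∀ {n} (X : Subset n) → ∣ X ∣ ≡ count (lookup X)
size≡count []          = refl
size≡count (true ∷ X)  = cong suc (size≡count X)
size≡count (false ∷ X) = size≡count X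

size-∩ : ∀ {n} (X Y : Subset n) → ∣ X ∩ Y ∣ ≡ count (λ v → lookup X v ∧ lookup Y v)
size-∩ X Y = trans (size≡count (X ∩ Y)) (count-cong (lookup-∩ X Y))

size>0⇒nonempty : ∀ {n} (X : Subset n) → 0 < ∣ X ∣ → Nonempty X
size>0⇒nonempty {n} X |X|>0 with nonempty? X
... | yes X≠∅ = X≠∅
... | no  X=∅ = contradiction (trans (cong ∣_∣ (Empty-unique X=∅)) (∣⊥∣≡0 n)) (>⇒≢ |X|>0)

select : ∀ {n} (X : Subset n) c → c ≤ ∣ X ∣ → Σ (Subset n) λ Y → Y ⊆ X × ∣ Y ∣ ≡ c
select {n} X zero _ = ⊥ , ⊥⊆ , ∣⊥∣≡0 n
select (true ∷ X) (suc c) c<|X| =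
  let Y , Y⊆X , |Y| = select X c (s≤s⁻¹ c<|X|) in true ∷ Y , s⊆s Y⊆X , cong suc |Y|
select (false ∷ X) (suc c) c<|X| =
  let Y , Y⊆X , |Y| = select X (suc c) c<|X| in false ∷ Y , s⊆s Y⊆X , |Y|

subset-overlap-bound : ∀ {n} (g A C : Subset n) → C ⊆ A → ∣ g ∩ A ∣ + ∣ C ∣ ≤ ∣ A ∣ + ∣ C ∩ g ∣
subset-overlap-bound g A C C⊆A = begin
  ∣ g ∩ A ∣ + ∣ C ∣                                        ≡⟨ cong₂ _+_ (size-∩ g A) (size≡count C) ⟩
  count (λ v → lookup g v ∧ lookup A v) + count (lookup C) ≡⟨ sym (∑-distrib-+ (λ v → χ (lookup g v ∧ lookup A v)) (χ ∘ lookup C)) ⟩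
  ∑[ v < _ ] (χ (lookup g v ∧ lookup A v) + χ (lookup C v)) ≤⟨ ∑-mono-≤ pointwise ⟩
  ∑[ v < _ ] (χ (lookup A v) + χ (lookup C v ∧ lookup g v)) ≡⟨ ∑-distrib-+ (χ ∘ lookup A) (λ v → χ (lookup C v ∧ lookup g v)) ⟩
  count (lookup A) + count (λ v → lookup C v ∧ lookup g v) ≡⟨ sym (cong₂ _+_ (size≡count A) (size-∩ C g)) ⟩
  ∣ A ∣ + ∣ C ∩ g ∣                                        ∎
  where
  open ≤-Reasoning
  bool-bound : ∀ x a c → (c ≡ true → a ≡ true) → χ (x ∧ a) + χ c ≤ χ a + χ (c ∧ x)
  bool-bound true  a     false _   = ≤-refl
  bool-bound false a     false _   = z≤n
  bool-bound x     false true  c⇒a with () ← c⇒a refl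
  bool-bound true  true  true  _   = ≤-refl
  bool-bound false true  true  _   = s≤s z≤n
  pointwise : ∀ v → χ (lookup g v ∧ lookup A v) + χ (lookup C v) ≤ χ (lookup A v) + χ (lookup C v ∧ lookup g v)
  pointwise v = bool-bound _ _ _ (λ Cv → []=⇒lookup (C⊆A (lookup⇒[]= v C Cv)))

-- The three-edge inequality for r-partite hypergraphs.

Transversal : ∀ {n r} → (Fin n → Fin r) → Subset n → Set
Transversal p x = ∀ j → ∣ x ∩ part p j ∣ ≡ 1

restrict : ∀ {n r} → (Fin n → Fin r) → Fin r → (Fin n → Bool) → Fin n → Bool
restrict p j P v = P v ∧ does (p v ≟ j)

-- Every point lies in exactly one part, so counts split over the parts.
count-by-parts : ∀ {n r} (p : Fin n → Fin r) (P : Fin n → Bool) →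
  count P ≡ ∑[ j < r ] count (restrict p j P)
count-by-parts {n} {r} p P = begin
  count P                                        ≡⟨ sym (sum-cong-≗ one-part) ⟩
  ∑[ v < n ] ∑[ j < r ] χ (restrict p j P v)     ≡⟨ ∑-comm (λ v j → χ (restrict p j P v)) ⟩
  ∑[ j < r ] count (restrict p j P)              ∎
  where
  open ≡-Reasoning
  one-part : ∀ v → ∑[ j < r ] χ (restrict p j P v) ≡ χ (P v)
  one-part v with P v
  ... | true  = count-≟ (p v)
  ... | false = ∑-zero r

∧-mask : ∀ a b m → (a ∧ b) ∧ m ≡ (a ∧ m) ∧ (b ∧ m)
∧-mask a b true  = trans (∧-identityʳ _) (sym (cong₂ _∧_ (∧-identityʳ a) (∧-identityʳ b)))
∧-mask a b false = trans (∧-zeroʳ _) (sym (cong₂ _∧_ (∧-zeroʳ a) (∧-zeroʳ b)))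

count-∧-by-parts : ∀ {n r} (p : Fin n → Fin r) (P Q : Fin n → Bool) →
  count (λ v → P v ∧ Q v) ≡ ∑[ j < r ] count (λ v → restrict p j P v ∧ restrict p j Q v)
count-∧-by-parts p P Q = trans (count-by-parts p (λ v → P v ∧ Q v))
  (sum-cong-≗ (λ j → count-cong (λ v → ∧-mask (P v) (Q v) (does (p v ≟ j)))))

transversal-count : ∀ {n r} (p : Fin n → Fin r) (x : Subset n) → Transversal p x →
  ∀ j → count (restrict p j (lookup x)) ≡ 1
transversal-count p x x-tr j = trans (sym (trans (size-∩ x (part p j)) (count-cong in-part))) (x-tr j)
  where
  in-part : ∀ v → lookup x v ∧ lookup (part p j) v ≡ restrict p j (lookup x) v
  in-part v = cong (lookup x v ∧_) (lookup∘tabulate (λ u → does (p u ≟ j)) v)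

transversal-size : ∀ {n r} (p : Fin n → Fin r) (x : Subset n) → Transversal p x → ∣ x ∣ ≡ r
transversal-size {r = r} p x x-tr = begin
  ∣ x ∣                                     ≡⟨ size≡count x ⟩
  count (lookup x)                          ≡⟨ count-by-parts p (lookup x) ⟩
  ∑[ j < r ] count (restrict p j (lookup x)) ≡⟨ sum-cong-≗ (transversal-count p x x-tr) ⟩
  ∑[ j < r ] 1                              ≡⟨ ∑-one r ⟩
  r                                         ∎
  where open ≡-Reasoning

atLeastTwo : Bool → Bool → Bool → Bool
atLeastTwo g e f = (g ∧ e) ∨ (g ∧ f) ∨ (e ∧ f)

pairs : ∀ {n} (G E F : Fin n → Bool) → ℕ
pairs G E F = count (λ v → G v ∧ E v) + count (λ v → G v ∧ F v) + count (λ v → E v ∧ F v)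

triple : ∀ {n} (G E F : Fin n → Bool) → ℕ
triple G E F = count (λ v → G v ∧ (E v ∧ F v))

-- A point in all three sets is counted three times by the pairs, a point in
-- exactly two sets once.
pairs≡ : ∀ {n} (G E F : Fin n → Bool) →
  pairs G E F ≡ count (λ v → atLeastTwo (G v) (E v) (F v)) + 2 * triple G E F
pairs≡ {n} G E F = begin
  pairs G E F
    ≡⟨ sym (∑-+₃ (λ v → χ (G v ∧ E v)) (λ v → χ (G v ∧ F v)) (λ v → χ (E v ∧ F v))) ⟩
  ∑[ v < n ] (χ (G v ∧ E v) + χ (G v ∧ F v) + χ (E v ∧ F v))
    ≡⟨ sum-cong-≗ (λ v → overlaps (G v) (E v) (F v)) ⟩
  ∑[ v < n ] (χ (two v) + 2 * χ (G v ∧ (E v ∧ F v)))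
    ≡⟨ ∑-distrib-+ (χ ∘ two) (λ v → 2 * χ (G v ∧ (E v ∧ F v))) ⟩
  count two + ∑[ v < n ] (2 * χ (G v ∧ (E v ∧ F v)))
    ≡⟨ cong (count two +_) (sym (*-distribˡ-sum 2 (λ v → χ (G v ∧ (E v ∧ F v))))) ⟩
  count two + 2 * triple G E F ∎
  where
  open ≡-Reasoning
  two : Fin n → Bool
  two v = atLeastTwo (G v) (E v) (F v)
  overlaps : ∀ g e f → χ (g ∧ e) + χ (g ∧ f) + χ (e ∧ f) ≡ χ (atLeastTwo g e f) + 2 * χ (g ∧ (e ∧ f))
  overlaps true  true  true  = refl
  overlaps true  true  false = refl
  overlaps true  false true  = refl
  overlaps true  false false = refl
  overlaps false true  true  = refl
  overlaps false true  false = refl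
  overlaps false false true  = refl
  overlaps false false false = refl

-- A point in at least two of the sets contributes at least two to their sizes.
twice-two≤ : ∀ {n} (G E F : Fin n → Bool) →
  2 * count (λ v → atLeastTwo (G v) (E v) (F v)) ≤ count G + count E + count F
twice-two≤ {n} G E F = begin
  2 * count (λ v → atLeastTwo (G v) (E v) (F v))
    ≡⟨ *-distribˡ-sum 2 (λ v → χ (atLeastTwo (G v) (E v) (F v))) ⟩
  ∑[ v < n ] (2 * χ (atLeastTwo (G v) (E v) (F v)))
    ≤⟨ ∑-mono-≤ (λ v → two-points (G v) (E v) (F v)) ⟩
  ∑[ v < n ] (χ (G v) + χ (E v) + χ (F v))
    ≡⟨ ∑-+₃ (χ ∘ G) (χ ∘ E) (χ ∘ F) ⟩
  count G + count E + count F ∎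
  where
  open ≤-Reasoning
  two-points : ∀ g e f → 2 * χ (atLeastTwo g e f) ≤ χ g + χ e + χ f
  two-points true  true  true  = s≤s (s≤s z≤n)
  two-points true  true  false = ≤-refl
  two-points true  false true  = ≤-refl
  two-points true  false false = z≤n
  two-points false true  true  = ≤-refl
  two-points false true  false = z≤n
  two-points false false true  = z≤n
  two-points false false false = z≤n

pairs-of-singletons : ∀ {n} (G E F : Fin n → Bool) → count G ≤ 1 → count E ≤ 1 → count F ≤ 1 →
  pairs G E F ≤ 1 + 2 * triple G E F
pairs-of-singletons G E F G≤1 E≤1 F≤1 = begin
  pairs G E F                                              ≡⟨ pairs≡ G E F ⟩
  count (λ v → atLeastTwo (G v) (E v) (F v)) + 2 * triple G E F ≤⟨ +-monoˡ-≤ (2 * triple G E F) two≤1 ⟩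
  1 + 2 * triple G E F                                     ∎
  where
  open ≤-Reasoning
  two≤1 : count (λ v → atLeastTwo (G v) (E v) (F v)) ≤ 1
  two≤1 = s≤s⁻¹ (*-cancelˡ-< 2 _ 2 (s≤s (≤-trans (twice-two≤ G E F) (+-mono-≤ (+-mono-≤ G≤1 E≤1) F≤1))))

three-edges : ∀ {n r} (p : Fin n → Fin r) (g e f : Subset n) →
  Transversal p g → Transversal p e → Transversal p f →
  ∣ g ∩ e ∣ + ∣ g ∩ f ∣ + ∣ e ∩ f ∣ ≤ r + 2 * ∣ g ∩ (e ∩ f) ∣
three-edges {n} {r} p g e f g-tr e-tr f-tr = begin
  ∣ g ∩ e ∣ + ∣ g ∩ f ∣ + ∣ e ∩ f ∣
    ≡⟨ cong₂ _+_ (cong₂ _+_ (size-∩ g e) (size-∩ g f)) (size-∩ e f) ⟩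
  pairs G E F
    ≡⟨ cong₂ _+_ (cong₂ _+_ (count-∧-by-parts p G E) (count-∧-by-parts p G F)) (count-∧-by-parts p E F) ⟩
  ∑[ j < r ] count (λ v → G↾ j v ∧ E↾ j v) + ∑[ j < r ] count (λ v → G↾ j v ∧ F↾ j v)
    + ∑[ j < r ] count (λ v → E↾ j v ∧ F↾ j v)
    ≡⟨ sym (∑-+₃ (λ j → count (λ v → G↾ j v ∧ E↾ j v)) (λ j → count (λ v → G↾ j v ∧ F↾ j v))
                 (λ j → count (λ v → E↾ j v ∧ F↾ j v))) ⟩
  ∑[ j < r ] pairs (G↾ j) (E↾ j) (F↾ j)
    ≤⟨ ∑-mono-≤ (λ j → pairs-of-singletons (G↾ j) (E↾ j) (F↾ j) (one g g-tr j) (one e e-tr j) (one f f-tr j)) ⟩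
  ∑[ j < r ] (1 + 2 * triple (G↾ j) (E↾ j) (F↾ j))
    ≡⟨ ∑-distrib-+ (λ _ → 1) (λ j → 2 * triple (G↾ j) (E↾ j) (F↾ j)) ⟩
  ∑[ j < r ] 1 + ∑[ j < r ] (2 * triple (G↾ j) (E↾ j) (F↾ j))
    ≡⟨ cong₂ _+_ (∑-one r) (sym (*-distribˡ-sum 2 (λ j → triple (G↾ j) (E↾ j) (F↾ j)))) ⟩
  r + 2 * ∑[ j < r ] triple (G↾ j) (E↾ j) (F↾ j)
    ≡⟨ cong (λ z → r + 2 * z) (sym triple-by-parts) ⟩
  r + 2 * triple G E F
    ≡⟨ cong (λ z → r + 2 * z) (sym (trans (size-∩ g (e ∩ f)) (count-cong (λ v → cong (G v ∧_) (lookup-∩ e f v))))) ⟩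
  r + 2 * ∣ g ∩ (e ∩ f) ∣ ∎
  where
  open ≤-Reasoning
  G E F : Fin n → Bool
  G = lookup g
  E = lookup e
  F = lookup f
  G↾ E↾ F↾ : Fin r → Fin n → Bool
  G↾ j = restrict p j G
  E↾ j = restrict p j E
  F↾ j = restrict p j F
  one : ∀ x → Transversal p x → ∀ j → count (restrict p j (lookup x)) ≤ 1
  one x x-tr j = ≤-reflexive (transversal-count p x x-tr j)
  triple-by-parts : triple G E F ≡ ∑[ j < r ] triple (G↾ j) (E↾ j) (F↾ j)
  triple-by-parts = trans (count-∧-by-parts p G (λ v → E v ∧ F v))
    (sum-cong-≗ (λ j → count-cong (λ v → cong (G↾ j v ∧_) (∧-mask (E v) (F v) (does (p v ≟ j))))))

double-half≤ : ∀ n → 2 * ⌊ n /2⌋ ≤ n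
double-half≤ n = begin
  2 * ⌊ n /2⌋       ≡⟨ cong (⌊ n /2⌋ +_) (+-identityʳ ⌊ n /2⌋) ⟩
  ⌊ n /2⌋ + ⌊ n /2⌋ ≤⟨ +-monoʳ-≤ ⌊ n /2⌋ (⌊n/2⌋≤⌈n/2⌉ n) ⟩
  ⌊ n /2⌋ + ⌈ n /2⌉ ≡⟨ ⌊n/2⌋+⌈n/2⌉≡n n ⟩
  n                 ∎
  where open ≤-Reasoning

<double-suc-half : ∀ n → n < 2 * suc ⌊ n /2⌋
<double-suc-half zero          = s≤s z≤n
<double-suc-half (suc zero)    = s≤s (s≤s z≤n)
<double-suc-half (suc (suc n)) =
  s≤s (s≤s (subst (suc n ≤_) (sym (+-suc h (suc h + 0))) (<double-suc-half n)))
  where h = ⌊ n /2⌋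

suc-half≤ : ∀ {r s} → s ≤ r → r < 3 * s → suc ⌊ (r ∸ s) /2⌋ ≤ s
suc-half≤ {r} {s} s≤r r<3s = ≰⇒> (λ s≤h → <⇒≱ r<3s (begin
  3 * s     ≡⟨ split-three s ⟩
  2 * s + s ≤⟨ +-monoˡ-≤ s (≤-trans (*-monoʳ-≤ 2 s≤h) (double-half≤ (r ∸ s))) ⟩
  r ∸ s + s ≡⟨ m∸n+n≡m s≤r ⟩
  r         ∎))
  where
  open ≤-Reasoning
  split-three : ∀ s → 3 * s ≡ 2 * s + s
  split-three = solve-∀

<+double-suc-half : ∀ r s → r < s + 2 * suc ⌊ (r ∸ s) /2⌋
<+double-suc-half r s = ≤-<-trans (m≤n+m∸n r s) (+-monoʳ-< s (<double-suc-half (r ∸ s)))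

suc-half≤r : ∀ {r} t → 0 < r → suc ⌊ (r ∸ t) /2⌋ ≤ r
suc-half≤r {suc r} t _ = ≤-trans (s≤s (⌊n/2⌋-mono (m∸n≤m (suc r) t))) (⌊n/2⌋<n r)

excess-positive : ∀ {r s a c z} → 3 * s ≤ r + 2 * a → r < s + 2 * c → a + c ≤ s + z → 0 < z
excess-positive {z = suc _} _ _ _ = s≤s z≤n
excess-positive {r} {s} {a} {c} {zero} 3s≤r+2a r<s+2c a+c≤s+0 =
  contradiction (+-cancelʳ-≤ (2 * s) (s + 2 * c) r (begin
    s + 2 * c + 2 * s ≡⟨ regroup₁ s c ⟩
    3 * s + 2 * c     ≤⟨ +-monoˡ-≤ (2 * c) 3s≤r+2a ⟩
    r + 2 * a + 2 * c ≡⟨ regroup₂ r a c ⟩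
    r + 2 * (a + c)   ≤⟨ +-monoʳ-≤ r (*-monoʳ-≤ 2 (≤-trans a+c≤s+0 (≤-reflexive (+-identityʳ s)))) ⟩
    r + 2 * s         ∎)) (<⇒≱ r<s+2c)
  where
  open ≤-Reasoning
  regroup₁ : ∀ s c → s + 2 * c + 2 * s ≡ 3 * s + 2 * c
  regroup₁ = solve-∀
  regroup₂ : ∀ r a c → r + 2 * a + 2 * c ≡ r + 2 * (a + c)
  regroup₂ = solve-∀

-- Upper bound.

-- If s = |e ∩ f| is at most |g ∩ e| and |g ∩ f|, then every C ⊆ e ∩ f with
-- r < s + 2|C| meets g: otherwise g ∩ e ∩ f and C are disjoint inside e ∩ f.
meets-edge : ∀ {n r} (p : Fin n → Fin r) (g e f C : Subset n) →
  Transversal p g → Transversal p e → Transversal p f →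
  ∣ e ∩ f ∣ ≤ ∣ g ∩ e ∣ → ∣ e ∩ f ∣ ≤ ∣ g ∩ f ∣ → C ⊆ e ∩ f → r < ∣ e ∩ f ∣ + 2 * ∣ C ∣ →
  Nonempty (C ∩ g)
meets-edge {r = r} p g e f C g-tr e-tr f-tr s≤ge s≤gf C⊆ef r<s+2c =
  size>0⇒nonempty (C ∩ g)
    (excess-positive {r} {∣ e ∩ f ∣} {∣ g ∩ (e ∩ f) ∣} {∣ C ∣} 3s≤r+2a r<s+2c (subset-overlap-bound g (e ∩ f) C C⊆ef))
  where
  three-copies : ∀ s → 3 * s ≡ s + s + s
  three-copies = solve-∀
  3s≤r+2a : 3 * ∣ e ∩ f ∣ ≤ r + 2 * ∣ g ∩ (e ∩ f) ∣
  3s≤r+2a = ≤-trans (≤-reflexive (three-copies ∣ e ∩ f ∣))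
    (≤-trans (+-monoˡ-≤ ∣ e ∩ f ∣ (+-mono-≤ s≤ge s≤gf)) (three-edges p g e f g-tr e-tr f-tr))

minimal-pair : ∀ {A : Set} (w : A → A → ℕ) (x : A) (xs : List A) →
  ∃₂ λ e f → e ∈ˡ x ∷ xs × f ∈ˡ x ∷ xs × (∀ {g h} → g ∈ˡ x ∷ xs → h ∈ˡ x ∷ xs → w e f ≤ w g h)
minimal-pair {A} w x xs = proj₁ best , proj₂ best , proj₁ best∈ , proj₂ best∈ , minimal
  where
  L : List A
  L = x ∷ xs
  best : A × A
  best = argmin (uncurry w) (x , x) (cartesianProduct L L)
  best∈ : proj₁ best ∈ˡ L × proj₂ best ∈ˡ L
  best∈ = argmin-all (uncurry w) {P = λ ef → proj₁ ef ∈ˡ L × proj₂ ef ∈ˡ L}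
    (here refl , here refl) (All.tabulate (∈-cartesianProduct⁻ L L))
  minimal : ∀ {g h} → g ∈ˡ L → h ∈ˡ L → uncurry w best ≤ w g h
  minimal g∈ h∈ = All.lookup (f[argmin]≤f[xs] {f = uncurry w} (x , x) (cartesianProduct L L))
    (∈-cartesianProduct⁺ g∈ h∈)

-- Every (r,t)-graph with r < 3t has a cover of size at most ⌊(r-t)/2⌋ + 1:
-- take ⌊(r-s)/2⌋ + 1 points of a minimal intersection e ∩ f, s = |e ∩ f|.
upper-bound : ∀ {r t} (H : Hypergraph) → IsRTGraph r t H → r < 3 * t →
  Σ (Subset (n H)) λ C → IsCover H C × ∣ C ∣ ≤ suc ⌊ (r ∸ t) /2⌋
upper-bound (hypergraph n []) _ _ = ⊥ , (λ ()) , subst (_≤ _) (sym (∣⊥∣≡0 n)) z≤n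
upper-bound {r} {t} (hypergraph n (x ∷ xs)) (uniform , (p , transversal) , intersecting) r<3t =
  C , covers , subst (_≤ suc ⌊ (r ∸ t) /2⌋) (sym |C|≡c) (s≤s (⌊n/2⌋-mono (∸-monoʳ-≤ r t≤s)))
  where
  pair = minimal-pair (λ e f → ∣ e ∩ f ∣) x xs
  e f : Subset n
  e = proj₁ pair
  f = proj₁ (proj₂ pair)
  e∈ = proj₁ (proj₂ (proj₂ pair))
  f∈ = proj₁ (proj₂ (proj₂ (proj₂ pair)))
  minimal = proj₂ (proj₂ (proj₂ (proj₂ pair)))
  s = ∣ e ∩ f ∣
  t≤s : t ≤ s
  t≤s = intersecting e∈ f∈
  s≤r : s ≤ r
  s≤r = ≤-trans (∣p∩q∣≤∣p∣ e f) (≤-reflexive (uniform e∈))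
  c = suc ⌊ (r ∸ s) /2⌋
  chosen = select (e ∩ f) c (suc-half≤ s≤r (<-≤-trans r<3t (*-monoʳ-≤ 3 t≤s)))
  C = proj₁ chosen
  C⊆ef = proj₁ (proj₂ chosen)
  |C|≡c = proj₂ (proj₂ chosen)
  covers : IsCover (hypergraph n (x ∷ xs)) C
  covers g∈ = meets-edge p _ e f C (transversal g∈) (transversal e∈) (transversal f∈)
    (minimal g∈ e∈) (minimal g∈ f∈) C⊆ef
    (subst (λ k → r < s + 2 * k) (sym |C|≡c) (<+double-suc-half r s))

-- The construction: for q = ρ + 1, words of length r over Fin q with at most ρ
-- nonzero letters, each giving the edge {(i, x_i)} of the grid Fin r × Fin q.
module Construction (r ρ : ℕ) where

  q : ℕ
  q = suc ρ

  -- The vertex set Fin (r * q) encodes the grid; the parts are its rows.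
  row : Fin (r * q) → Fin r
  row v = proj₁ (remQuot {r} q v)

  letter : Fin (r * q) → Fin q
  letter v = proj₂ (remQuot {r} q v)

  count-grid : (P : Fin r → Fin q → Bool) → count (λ v → P (row v) (letter v)) ≡ ∑[ i < r ] count (P i)
  count-grid P = trans (∑-combine r (λ v → χ (P (row v) (letter v))))
    (sum-cong-≗ (λ i → sum-cong-≗ (λ a → cong (χ ∘ uncurry P) (remQuot-combine {r} i a))))

  nonzero : Fin q → Bool
  nonzero F.zero    = false
  nonzero (F.suc _) = true

  nonzero-false : ∀ {a} → nonzero a ≡ false → a ≡ F.zero
  nonzero-false {F.zero} _ = refl

  Word : Set
  Word = Vec (Fin q) r

  weight : Word → ℕ
  weight x = count (nonzero ∘ lookup x)

  all-words : ∀ m → List (Vec (Fin q) m)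
  all-words zero    = [] ∷ []
  all-words (suc m) = cartesianProductWith _∷_ (allFin q) (all-words m)

  all-words-complete : ∀ {m} (x : Vec (Fin q) m) → x ∈ˡ all-words m
  all-words-complete []      = here refl
  all-words-complete (a ∷ x) = ∈-cartesianProductWith⁺ _∷_ (∈-allFin a) (all-words-complete x)

  edge : Word → Subset (r * q)
  edge x = tabulate (λ v → does (lookup x (row v) ≟ letter v))

  lookup-edge : ∀ x v → lookup (edge x) v ≡ does (lookup x (row v) ≟ letter v)
  lookup-edge x v = lookup∘tabulate (λ u → does (lookup x (row u) ≟ letter u)) v

  word-edges : List (Subset (r * q))
  word-edges = map edge (filter (λ x → weight x ≤? ρ) (all-words r))

  H₀ : Hypergraph
  H₀ = hypergraph (r * q) word-edges

  word-edges⁻ : ∀ {e} → e ∈ˡ word-edges → ∃ λ x → weight x ≤ ρ × e ≡ edge x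
  word-edges⁻ e∈ with ∈-map⁻ edge e∈
  ... | x , x∈ , e≡ = x , proj₂ (∈-filter⁻ (λ x → weight x ≤? ρ) {xs = all-words r} x∈) , e≡

  word-edges⁺ : ∀ x → weight x ≤ ρ → edge x ∈ˡ word-edges
  word-edges⁺ x wx = ∈-map⁺ edge (∈-filter⁺ (λ x → weight x ≤? ρ) (all-words-complete x) wx)

  edge-transversal : ∀ x → Transversal row (edge x)
  edge-transversal x j = begin
    ∣ edge x ∩ part row j ∣
      ≡⟨ size-∩ (edge x) (part row j) ⟩
    count (λ v → lookup (edge x) v ∧ lookup (part row j) v)
      ≡⟨ count-cong (λ v → cong₂ _∧_ (lookup-edge x v) (lookup∘tabulate (λ u → does (row u ≟ j)) v)) ⟩
    count (λ v → does (lookup x (row v) ≟ letter v) ∧ does (row v ≟ j))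
      ≡⟨ count-grid (λ i a → does (lookup x i ≟ a) ∧ does (i ≟ j)) ⟩
    ∑[ i < r ] count (λ a → does (lookup x i ≟ a) ∧ does (i ≟ j))
      ≡⟨ sum-cong-≗ (λ i → count-at (lookup x i) (λ _ → does (i ≟ j))) ⟩
    count (λ i → does (i ≟ j))
      ≡⟨ count-≟′ j ⟩
    1 ∎
    where open ≡-Reasoning

  edge-∩ : ∀ x y → ∣ edge x ∩ edge y ∣ ≡ count (λ i → does (lookup y i ≟ lookup x i))
  edge-∩ x y = begin
    ∣ edge x ∩ edge y ∣
      ≡⟨ size-∩ (edge x) (edge y) ⟩
    count (λ v → lookup (edge x) v ∧ lookup (edge y) v)
      ≡⟨ count-cong (λ v → cong₂ _∧_ (lookup-edge x v) (lookup-edge y v)) ⟩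
    count (λ v → does (lookup x (row v) ≟ letter v) ∧ does (lookup y (row v) ≟ letter v))
      ≡⟨ count-grid (λ i a → does (lookup x i ≟ a) ∧ does (lookup y i ≟ a)) ⟩
    ∑[ i < r ] count (λ a → does (lookup x i ≟ a) ∧ does (lookup y i ≟ a))
      ≡⟨ sum-cong-≗ (λ i → count-at (lookup x i) (λ a → does (lookup y i ≟ a))) ⟩
    count (λ i → does (lookup y i ≟ lookup x i)) ∎
    where open ≡-Reasoning

  -- Two words agree in every row where both letters are zero.
  agreement-bound : ∀ x y → r ≤ ∣ edge x ∩ edge y ∣ + (weight x + weight y)
  agreement-bound x y = begin
    r
      ≡⟨ sym (∑-one r) ⟩
    ∑[ i < r ] 1
      ≤⟨ ∑-mono-≤ (λ i → agree-or-nonzero (lookup x i) (lookup y i)) ⟩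
    ∑[ i < r ] (agree i + (χ (nonzero (lookup x i)) + χ (nonzero (lookup y i))))
      ≡⟨ ∑-distrib-+ agree (λ i → χ (nonzero (lookup x i)) + χ (nonzero (lookup y i))) ⟩
    sum agree + ∑[ i < r ] (χ (nonzero (lookup x i)) + χ (nonzero (lookup y i)))
      ≡⟨ cong₂ _+_ (sym (edge-∩ x y)) (∑-distrib-+ (χ ∘ nonzero ∘ lookup x) (χ ∘ nonzero ∘ lookup y)) ⟩
    ∣ edge x ∩ edge y ∣ + (weight x + weight y) ∎
    where
    open ≤-Reasoning
    agree : Fin r → ℕ
    agree i = χ (does (lookup y i ≟ lookup x i))
    agree-or-nonzero : ∀ (b c : Fin q) → 1 ≤ χ (does (c ≟ b)) + (χ (nonzero b) + χ (nonzero c))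
    agree-or-nonzero F.zero    F.zero    = s≤s z≤n
    agree-or-nonzero F.zero    (F.suc c) = s≤s z≤n
    agree-or-nonzero (F.suc b) c         = ≤-trans (s≤s z≤n) (m≤n+m (suc (χ (nonzero c))) _)

  intersecting : ∀ {t} → t ≤ r → 2 * ρ ≤ r ∸ t → IsIntersecting t H₀
  intersecting {t} t≤r 2ρ≤r-t e∈ f∈ with word-edges⁻ e∈ | word-edges⁻ f∈
  ... | x , wx , refl | y , wy , refl = +-cancelʳ-≤ (r ∸ t) t ∣ edge x ∩ edge y ∣ (begin
    t + (r ∸ t)                                ≡⟨ m+[n∸m]≡n t≤r ⟩
    r                                          ≤⟨ agreement-bound x y ⟩
    ∣ edge x ∩ edge y ∣ + (weight x + weight y) ≤⟨ +-monoʳ-≤ ∣ edge x ∩ edge y ∣ weights≤ ⟩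
    ∣ edge x ∩ edge y ∣ + (r ∸ t)              ∎)
    where
    open ≤-Reasoning
    weights≤ : weight x + weight y ≤ r ∸ t
    weights≤ = ≤-trans (+-mono-≤ wx wy) (≤-trans (≤-reflexive (cong (ρ +_) (sym (+-identityʳ ρ)))) 2ρ≤r-t)

  isRTGraph : ∀ {t} → t ≤ r → 2 * ρ ≤ r ∸ t → IsRTGraph r t H₀
  isRTGraph t≤r 2ρ≤r-t = uniform , (row , transversal) , intersecting t≤r 2ρ≤r-t
    where
    transversal : ∀ {e} → e ∈ˡ word-edges → Transversal row e
    transversal e∈ with word-edges⁻ e∈
    ... | x , _ , refl = edge-transversal x
    uniform : IsUniform r H₀
    uniform {e} e∈ = transversal-size row e (transversal e∈)

  zeros : Subset r → Subset (r * q)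
  zeros S = tabulate (λ v → lookup S (row v) ∧ not (nonzero (letter v)))

  ∣zeros∣ : ∀ S → ∣ zeros S ∣ ≡ ∣ S ∣
  ∣zeros∣ S = begin
    ∣ zeros S ∣
      ≡⟨ size≡count (zeros S) ⟩
    count (lookup (zeros S))
      ≡⟨ count-cong (lookup∘tabulate (λ v → lookup S (row v) ∧ not (nonzero (letter v)))) ⟩
    count (λ v → lookup S (row v) ∧ not (nonzero (letter v)))
      ≡⟨ count-grid (λ i a → lookup S i ∧ not (nonzero a)) ⟩
    ∑[ i < r ] count (λ a → lookup S i ∧ not (nonzero a))
      ≡⟨ sum-cong-≗ (λ i → one-zero (lookup S i)) ⟩
    count (lookup S)
      ≡⟨ sym (size≡count S) ⟩
    ∣ S ∣ ∎
    where
    open ≡-Reasoning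
    one-zero : ∀ β → count (λ a → β ∧ not (nonzero a)) ≡ χ β
    one-zero true  = cong suc (∑-zero ρ)
    one-zero false = ∑-zero q

  -- With more than ρ rows, every word of weight ≤ ρ has the letter 0 in one of them.
  zeros-cover : ∀ S → ρ < ∣ S ∣ → IsCover H₀ (zeros S)
  zeros-cover S ρ<|S| e∈ with word-edges⁻ e∈
  ... | x , wx , refl = v , x∈p∩q⁺ (lookup⇒[]= v (zeros S) v∈zeros , lookup⇒[]= v (edge x) v∈edge)
    where
    witness = count-<⇒witness (nonzero ∘ lookup x) (lookup S) (≤-<-trans wx (subst (ρ <_) (size≡count S) ρ<|S|))
    i = proj₁ witness
    v = combine i F.zero
    v∈zeros : lookup (zeros S) v ≡ true
    v∈zeros = trans (lookup∘tabulate (λ u → lookup S (row u) ∧ not (nonzero (letter u))) v)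
      (trans (cong (uncurry (λ j a → lookup S j ∧ not (nonzero a))) (remQuot-combine {r} {q} i F.zero))
             (cong (_∧ true) (proj₁ (proj₂ witness))))
    v∈edge : lookup (edge x) v ≡ true
    v∈edge = trans (lookup-edge x v)
      (trans (cong (uncurry (λ j a → does (lookup x j ≟ a))) (remQuot-combine {r} {q} i F.zero))
             (cong (λ b → does (b ≟ F.zero)) (nonzero-false (proj₂ (proj₂ witness)))))

  ≟-sound : ∀ {a b : Fin q} → does (a ≟ b) ≡ true → a ≡ b
  ≟-sound {a} {b} eq with a ≟ b
  ... | yes a≡b = a≡b

  -- A set C of at most ρ points misses the edge of the word that takes in each
  -- row a letter outside C, nonzero only when (i, 0) ∈ C.
  small-sets-miss : ∀ (C : Subset (r * q)) → ∣ C ∣ ≤ ρ → ∃ λ x → weight x ≤ ρ × Empty (C ∩ edge x)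
  small-sets-miss C |C|≤ρ = x , weight-x , misses
    where
    column : Fin r → Fin q → Bool
    column i a = lookup C (combine i a)
    |C|≡ : ∣ C ∣ ≡ ∑[ i < r ] count (column i)
    |C|≡ = trans (size≡count C) (∑-combine r (χ ∘ lookup C))
    column-short : ∀ i → count (column i) < count {q} (λ _ → true)
    column-short i = subst (count (column i) <_) (sym (∑-one q))
      (s≤s (≤-trans (term≤∑ (count ∘ column) i) (≤-trans (≤-reflexive (sym |C|≡)) |C|≤ρ)))
    avoid : ∀ i → Σ (Fin q) λ a → column i a ≡ false × χ (nonzero a) ≤ χ (column i F.zero)
    avoid i with column i F.zero in c0
    ... | false = F.zero , c0 , z≤n
    ... | true  = let a , _ , free = count-<⇒witness (column i) (λ _ → true) (column-short i) in
                  a , free , χ≤1 (nonzero a)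
    x : Word
    x = tabulate (proj₁ ∘ avoid)
    weight-x : weight x ≤ ρ
    weight-x = begin
      weight x                                 ≡⟨ count-cong (λ i → cong nonzero (lookup∘tabulate (proj₁ ∘ avoid) i)) ⟩
      ∑[ i < r ] χ (nonzero (proj₁ (avoid i))) ≤⟨ ∑-mono-≤ (proj₂ ∘ proj₂ ∘ avoid) ⟩
      ∑[ i < r ] χ (column i F.zero)           ≤⟨ ∑-mono-≤ (λ i → term≤∑ (χ ∘ column i) F.zero) ⟩
      ∑[ i < r ] count (column i)              ≡⟨ sym |C|≡ ⟩
      ∣ C ∣                                    ≤⟨ |C|≤ρ ⟩
      ρ                                        ∎
      where open ≤-Reasoning
    hit : ∀ v → v ∈ C ∩ edge x → column (row v) (proj₁ (avoid (row v))) ≡ true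
    hit v v∈C∩e = begin
      column (row v) (proj₁ (avoid (row v))) ≡⟨ cong (column (row v)) same-letter ⟩
      column (row v) (letter v)              ≡⟨ cong (lookup C) (combine-remQuot {r} q v) ⟩
      lookup C v                             ≡⟨ []=⇒lookup (proj₁ (x∈p∩q⁻ C (edge x) v∈C∩e)) ⟩
      true                                   ∎
      where
      open ≡-Reasoning
      same-letter : proj₁ (avoid (row v)) ≡ letter v
      same-letter = trans (sym (lookup∘tabulate (proj₁ ∘ avoid) (row v)))
        (≟-sound (trans (sym (lookup-edge x v)) ([]=⇒lookup (proj₂ (x∈p∩q⁻ C (edge x) v∈C∩e)))))
    misses : Empty (C ∩ edge x)
    misses (v , v∈C∩e) with () ← trans (sym (proj₁ (proj₂ (avoid (row v))))) (hit v v∈C∩e)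

  cover-large : ∀ C → IsCover H₀ C → q ≤ ∣ C ∣
  cover-large C covers = ≮⇒≥ λ |C|<q →
    let x , wx , misses = small-sets-miss C (s≤s⁻¹ |C|<q) in misses (covers (word-edges⁺ x wx))

  cover-number : q ≤ r → CoverNumber H₀ q
  cover-number q≤r = (zeros S , zeros-cover S (≤-reflexive (sym |S|≡q)) , trans (∣zeros∣ S) |S|≡q) , cover-large
    where
    rows = select ⊤ q (subst (q ≤_) (sym (∣⊤∣≡n r)) q≤r)
    S = proj₁ rows
    |S|≡q = proj₂ (proj₂ rows)

theorem1p4 : ∀ (t r : ℕ) → t + 1 ≤ r → r + 1 ≤ 3 * t →
    IsR r t (⌊ (r ∸ t) /2⌋ + 1)
theorem1p4 t r t+1≤r r+1≤3t =
  subst (IsR r t) (+-comm 1 ρ) ((H₀ , isRTGraph t≤r (double-half≤ (r ∸ t)) , cover-number q≤r) , bounded)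
  where
  ρ = ⌊ (r ∸ t) /2⌋
  open Construction r ρ
  t≤r : t ≤ r
  t≤r = ≤-trans (m≤m+n t 1) t+1≤r
  q≤r : suc ρ ≤ r
  q≤r = suc-half≤r t (m+n≤o⇒n≤o t t+1≤r)
  r<3t : r < 3 * t
  r<3t = subst (_≤ 3 * t) (+-comm r 1) r+1≤3t
  bounded : ∀ H → IsRTGraph r t H → ∀ k → CoverNumber H k → k ≤ suc ρ
  bounded H H-rt k (_ , minimum) =
    let C , covers , |C|≤ = upper-bound H H-rt r<3t in ≤-trans (minimum C covers) |C|≤
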